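{- Let $r$ be a positive integer and let $\vec{G}$ be an orientation of a graph $G$ representing $(\le\!r)$-distances. For a set $X\subseteq V(G)$, let $Y_{\vec{G},r}(X)$ be the set of vertices $y$ such that $\vec{G}$ contains a walk from $y$ to $X$ of length at most $r$ directed away from $y$. Then for any $(\le\!r)$-distance determined problem, a set $B\subseteq V(G)\setminus Y_{\vec{G},r}(X)$ is admissible in $G$ if and only if it is admissible in $G-X$.
   Context: An orientation of $G$ is a directed graph $\vec{G}$ on $V(G)$ such that $uv\in E(G)$ iff $\vec{G}$ contains at least one of $(u,v)$, $(v,u)$ (both allowed). A walk in $\vec{G}$ is a sequence $v_0\dots v_b$ with $(v_{i-1},v_i)$ or $(v_i,v_{i-1})$ an edge for each $i$ (length $b$); it is inward-directed if for some $s$, $(v_i,v_{i+1})\in E(\vec{G})$ for $i<s$ and $(v_i,v_{i-1})\in E(\vec{G})$ for $i>s$. $\vec{G}$ represents $(\le\!r)$-distances if for all $u,v\in V(G)$ and $b\in\{0,\dots,r\}$, $d_G(u,v)\le b$ iff $\vec{G}$ has an inward-directed walk of length at most $b$ between $u$ and $v$. A walk from $y$ to $X$ of length at most $r$ directed away from $y$ is a sequence $y=v_0,\dots,v_t$ with $t\le r$, $(v_{i-1},v_i)\in E(\vec{G})$ for all $i$, and $v_t\in X$. A problem specifies, for every graph, which vertex subsets are admissible. It is $(\le\!r)$-distance determined if for any graphs $G,G'$, sets $X\subseteq V(G)$, $X'\subseteq V(G')$ and bijection $\varphi:X\to X'$ with $\min(r,d_G(u,v))=\min(r,d_{G'}(\varphi(u),\varphi(v)))$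 for all $u,v\in X$, $X$ is admissible in $G$ iff $X'$ is admissible in $G'$. -}

module Defs where

open import Data.Nat using (ℕ; zero; suc; _≤_; _<_; _∸_)
open import Data.Bool using (Bool; true; false)
open import Data.List using (List; []; _∷_)
open import Data.List.Relation.Unary.Any using (here; there)
open import Data.List.Membership.Propositional using (_∈_)
open import Data.Product using (Σ; ∃; ∃-syntax; _×_; _,_; proj₁; proj₂)
open import Data.Sum using (_⊎_)
open import Relation.Nullary using (¬_)
open import Relation.Binary.PropositionalEquality using (_≡_; refl; trans; sym; cong)
open import Function.Bundles using (_⇔_; _⤖_; Bijection)

record Graph : Set₁ where
  field
    V        : Set
    E        : V → V → Set
    E-sym    : ∀ {u v} → E u v → E v u
    E-irrefl : ∀ {v} → ¬ E v v
    vertices : List V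
    complete : ∀ v → v ∈ vertices
open Graph public

Subset : Graph → Set
Subset G = V G → Bool

Elems : (G : Graph) → Subset G → Set
Elems G S = Σ (V G) (λ v → S v ≡ true)

record Walk (G : Graph) (u v : V G) (b : ℕ) : Set where
  field
    seq   : ℕ → V G
    start : seq 0 ≡ u
    end   : seq b ≡ v
    steps : ∀ i → i < b → E G (seq i) (seq (suc i))

DistLE : (G : Graph) → V G → V G → ℕ → Set
DistLE G u v b = ∃[ b' ] (b' ≤ b × Walk G u v b')

-- min(r, d_G(u,v)) ≡ k  (d_G(u,v) may be ∞)
TruncDist : (G : Graph) → ℕ → V G → V G → ℕ → Set
TruncDist G r u v k =
  k ≤ r × (∀ j → j < k → ¬ DistLE G u v j) × (k < r → DistLE G u v k)

IsOrientation : (G : Graph) → (V G → V G → Set) → Set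
IsOrientation G D = ∀ u v → E G u v ⇔ (D u v ⊎ D v u)

record OWalk (G : Graph) (D : V G → V G → Set) (u v : V G) (b : ℕ) : Set where
  field
    seq   : ℕ → V G
    start : seq 0 ≡ u
    end   : seq b ≡ v
    steps : ∀ i → i < b → D (seq i) (seq (suc i)) ⊎ D (seq (suc i)) (seq i)
open OWalk public

InwardDirected : (G : Graph) (D : V G → V G → Set) {u v : V G} {b : ℕ}
               → OWalk G D u v b → Set
InwardDirected G D {b = b} w =
  ∃[ s ] (s ≤ b
         × (∀ i → i < s → D (seq w i) (seq w (suc i)))
         × (∀ i → s < i → i ≤ b → D (seq w i) (seq w (i ∸ 1))))

InwardWalkFrom : (G : Graph) (D : V G → V G → Set) → V G → V G → ℕ → Set
InwardWalkFrom G D u v b = Σ (OWalk G D u v b) (InwardDirected G D)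

InwardLE : (G : Graph) (D : V G → V G → Set) → V G → V G → ℕ → Set
InwardLE G D u v b =
  ∃[ b' ] (b' ≤ b × (InwardWalkFrom G D u v b' ⊎ InwardWalkFrom G D v u b'))

RepresentsDistances : (r : ℕ) (G : Graph) (D : V G → V G → Set) → Set
RepresentsDistances r G D =
  ∀ u v b → b ≤ r → DistLE G u v b ⇔ InwardLE G D u v b

Y : (G : Graph) (D : V G → V G → Set) → ℕ → Subset G → V G → Set
Y G D r X y =
  Σ ℕ λ t → Σ (ℕ → V G) λ f →
    t ≤ r × f 0 ≡ y × X (f t) ≡ true × (∀ i → i < t → D (f i) (f (suc i)))

bool-uip : ∀ {b c : Bool} (p q : b ≡ c) → p ≡ q
bool-uip refl refl = refl

module _ {A : Set} (X : A → Bool) where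
  keepStep : (a : A) (b : Bool) → X a ≡ b
           → List (Σ A (λ v → X v ≡ false)) → List (Σ A (λ v → X v ≡ false))
  keepStep a true  e rest = rest
  keepStep a false e rest = (a , e) ∷ rest

  keep : List A → List (Σ A (λ v → X v ≡ false))
  keep [] = []
  keep (a ∷ as) = keepStep a (X a) refl (keep as)

  keepStep-here : ∀ a b (e : X a ≡ b) (p : X a ≡ false) rest → (a , p) ∈ keepStep a b e rest
  keepStep-here a true  e p rest with trans (sym e) p
  ... | ()
  keepStep-here a false e p rest = here (cong (a ,_) (bool-uip p e))

  keepStep-there : ∀ a b (e : X a ≡ b) w rest → w ∈ rest → w ∈ keepStep a b e rest
  keepStep-there a true  e w rest m = m
  keepStep-there a false e w rest m = there m

  keep-complete : ∀ (w : Σ A (λ v → X v ≡ false)) as → proj₁ w ∈ as → w ∈ keep as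
  keep-complete (a , p) (a ∷ as) (here refl) = keepStep-here a (X a) refl p (keep as)
  keep-complete w (b ∷ as) (there m) =
    keepStep-there b (X b) refl w (keep as) (keep-complete w as m)

_─_ : (G : Graph) → Subset G → Graph
G ─ X = record
  { V        = Σ (V G) (λ v → X v ≡ false)
  ; E        = λ u v → E G (proj₁ u) (proj₁ v)
  ; E-sym    = E-sym G
  ; E-irrefl = E-irrefl G
  ; vertices = keep X (vertices G)
  ; complete = λ w → keep-complete X w (vertices G) (complete G (proj₁ w))
  }

Problem : Set₁
Problem = (G : Graph) → Subset G → Set

DistanceDetermined : ℕ → Problem → Set₁
DistanceDetermined r P =
  (G G' : Graph) (X : Subset G) (X' : Subset G') (φ : Elems G X ⤖ Elems G' X')
  → (∀ (u v : Elems G X) (k : ℕ) →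
       TruncDist G r (proj₁ u) (proj₁ v) k
         ⇔ TruncDist G' r (proj₁ (Bijection.to φ u)) (proj₁ (Bijection.to φ v)) k)
  → P G X ⇔ P G' X'

module Submission where

-- Every vertex of an inward-directed walk lies on a directed walk leaving one
-- of its ends, of length at most r.  So if both ends avoid Y, the walks that
-- witness distances up to r between them avoid X and survive in G ─ X;
-- hence truncated distances inside B are the same in G and in G ─ X.

open import Defs
open import Data.Nat using (ℕ; suc; _≤_; _<_; _∸_; _⊓_; z≤n; s≤s)
open import Data.Nat.Properties
open import Data.Bool using (true; false)
open import Data.Product using (_,_; proj₁)
open import Data.Sum using (inj₁; inj₂)
open import Data.Empty using (⊥-elim)
open import Relation.Nullary using (¬_; yes; no)
open import Relation.Binary.PropositionalEquality
  using (_≡_; refl; sym; trans; cong; subst; subst₂)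
open import Function.Bundles using (_⇔_; mk⇔; Equivalence; mk↔ₛ′; _⤖_)
open import Function.Properties.Inverse using (↔⇒⤖)
import Function.Properties.Equivalence as ⇔

reverseWalk : (G : Graph) {u v : V G} {b : ℕ} → Walk G u v b → Walk G v u b
reverseWalk G {b = b} w = record
  { seq   = λ i → Walk.seq w (b ∸ i)
  ; start = Walk.end w
  ; end   = trans (cong (Walk.seq w) (n∸n≡0 b)) (Walk.start w)
  ; steps = λ i i<b →
      subst (λ k → E G (Walk.seq w k) (Walk.seq w (b ∸ suc i)))
        (sym (+-∸-assoc 1 i<b))
        (E-sym G (Walk.steps w (b ∸ suc i) (∸-monoʳ-< (s≤s z≤n) i<b)))
  }

owalk⇒walk : {G : Graph} {D : V G → V G → Set} → IsOrientation G D
           → {u v : V G} {b : ℕ} → OWalk G D u v b → Walk G u v b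
owalk⇒walk ori w = record
  { seq   = seq w
  ; start = start w
  ; end   = end w
  ; steps = λ i i<b → Equivalence.from (ori (seq w i) (seq w (suc i))) (steps w i i<b)
  }

module _ (G : Graph) (X : Subset G) where

  ─-vertex-≡ : {u v : V G} (pu : X u ≡ false) (pv : X v ≡ false)
             → u ≡ v → _≡_ {A = V (G ─ X)} (u , pu) (v , pv)
  ─-vertex-≡ pu pv refl = cong (_ ,_) (bool-uip pu pv)

  walk-─⇒walk : {u v : V G} {b : ℕ} {pu : X u ≡ false} {pv : X v ≡ false}
              → Walk (G ─ X) (u , pu) (v , pv) b → Walk G u v b
  walk-─⇒walk w = record
    { seq   = λ i → proj₁ (Walk.seq w i)
    ; start = cong proj₁ (Walk.start w)
    ; end   = cong proj₁ (Walk.end w)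
    ; steps = Walk.steps w
    }

  -- Beyond its length the walk is frozen at its last vertex (index i ⊓ b),
  -- so that every index carries a vertex of G ─ X.
  walk⇒walk-─ : {u v : V G} {b : ℕ} (w : Walk G u v b)
              → (∀ i → i ≤ b → X (Walk.seq w i) ≡ false)
              → (pu : X u ≡ false) (pv : X v ≡ false)
              → Walk (G ─ X) (u , pu) (v , pv) b
  walk⇒walk-─ {b = b} w avoids pu pv = record
    { seq   = λ i → Walk.seq w (i ⊓ b) , avoids (i ⊓ b) (m⊓n≤n i b)
    ; start = ─-vertex-≡ _ pu (Walk.start w)
    ; end   = ─-vertex-≡ _ pv (trans (cong (Walk.seq w) (m≤n⇒m⊓n≡m (≤-refl {b}))) (Walk.end w))
    ; steps = λ i i<b →
        subst₂ (λ k l → E G (Walk.seq w k) (Walk.seq w l))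
          (sym (m≤n⇒m⊓n≡m (<⇒≤ i<b))) (sym (m≤n⇒m⊓n≡m i<b))
          (Walk.steps w i i<b)
    }

module _ (r : ℕ) (G : Graph) (D : V G → V G → Set) (X : Subset G) where

  ¬Y⇒∉X : {v : V G} → ¬ Y G D r X v → X v ≡ false
  ¬Y⇒∉X {v} v∉Y with X v in v∈X
  ... | false = refl
  ... | true  = ⊥-elim (v∉Y (0 , (λ _ → v) , z≤n , refl , v∈X , λ _ ()))

  -- The part of the walk up to the turning point s is directed away from a,
  -- the part after it, read backwards, is directed away from c.
  inwardWalk-avoids : {a c : V G} {b : ℕ} → b ≤ r
                    → ¬ Y G D r X a → ¬ Y G D r X c
                    → (w : OWalk G D a c b) → InwardDirected G D w
                    → ∀ i → i ≤ b → X (seq w i) ≡ false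
  inwardWalk-avoids {b = b} b≤r a∉Y c∉Y w (s , _ , forward , backward) i i≤b
    with X (seq w i) in i∈X | i ≤? s
  ... | false | _       = refl
  ... | true  | yes i≤s =
    ⊥-elim (a∉Y (i , seq w , ≤-trans i≤b b≤r , start w , i∈X ,
                 λ j j<i → forward j (<-≤-trans j<i i≤s)))
  ... | true  | no  i≰s =
    ⊥-elim (c∉Y (b ∸ i , (λ j → seq w (b ∸ j)) , ≤-trans (m∸n≤m b i) b≤r , end w ,
                 subst (λ k → X (seq w k) ≡ true) (sym (m∸[m∸n]≡n i≤b)) i∈X ,
                 backward-step))
    where
    s<b∸j : ∀ j → j < b ∸ i → s < b ∸ j
    s<b∸j j j<b∸i = <-≤-trans (≰⇒> i≰s)
      (subst (_≤ b ∸ j) (m∸[m∸n]≡n i≤b) (∸-monoʳ-≤ b (<⇒≤ j<b∸i)))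

    backward-step : ∀ j → j < b ∸ i → D (seq w (b ∸ j)) (seq w (b ∸ suc j))
    backward-step j j<b∸i =
      subst (λ k → D (seq w (b ∸ j)) (seq w k))
        (trans (∸-+-assoc b j 1) (cong (b ∸_) (+-comm j 1)))
        (backward (b ∸ j) (s<b∸j j j<b∸i) (m∸n≤m b j))

TruncDist-cong : {G H : Graph} {r : ℕ} {u v : V G} {u' v' : V H}
               → (∀ j → j ≤ r → DistLE G u v j ⇔ DistLE H u' v' j)
               → ∀ k → TruncDist G r u v k ⇔ TruncDist H r u' v' k
TruncDist-cong same k = mk⇔ (transport same) (transport (λ j j≤r → ⇔.sym (same j j≤r)))
  where
  transport : {G H : Graph} {r : ℕ} {u v : V G} {u' v' : V H}
            → (∀ j → j ≤ r → DistLE G u v j ⇔ DistLE H u' v' j)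
            → TruncDist G r u v k → TruncDist H r u' v' k
  transport same (k≤r , far , near) =
    k≤r ,
    (λ j j<k d → far j j<k (Equivalence.from (same j (<⇒≤ (<-≤-trans j<k k≤r))) d)) ,
    (λ k<r → Equivalence.to (same k k≤r) (near k<r))

module _ (r : ℕ) (G : Graph) (D : V G → V G → Set)
         (ori : IsOrientation G D) (rep : RepresentsDistances r G D) (X : Subset G) where

  DistLE-─ : {u v : V G} (u∉Y : ¬ Y G D r X u) (v∉Y : ¬ Y G D r X v)
           → ∀ b → b ≤ r
           → DistLE G u v b ⇔ DistLE (G ─ X) (u , ¬Y⇒∉X r G D X u∉Y) (v , ¬Y⇒∉X r G D X v∉Y) b
  DistLE-─ {u} {v} u∉Y v∉Y b b≤r = mk⇔ shorten lift
    where
    avoiding : {a c : V G} {b' : ℕ} → b' ≤ b → (a∉Y : ¬ Y G D r X a) (c∉Y : ¬ Y G D r X c)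
             → InwardWalkFrom G D a c b'
             → Walk (G ─ X) (a , ¬Y⇒∉X r G D X a∉Y) (c , ¬Y⇒∉X r G D X c∉Y) b'
    avoiding b'≤b a∉Y c∉Y (w , inward) =
      walk⇒walk-─ G X (owalk⇒walk ori w)
        (inwardWalk-avoids r G D X (≤-trans b'≤b b≤r) a∉Y c∉Y w inward) _ _

    shorten : DistLE G u v b → DistLE (G ─ X) _ _ b
    shorten d with Equivalence.to (rep u v b b≤r) d
    ... | b' , b'≤b , inj₁ w = b' , b'≤b , avoiding b'≤b u∉Y v∉Y w
    ... | b' , b'≤b , inj₂ w = b' , b'≤b , reverseWalk (G ─ X) (avoiding b'≤b v∉Y u∉Y w)

    lift : DistLE (G ─ X) _ _ b → DistLE G u v b
    lift (b' , b'≤b , w) = b' , b'≤b , walk-─⇒walk G X w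

Elems-─ : (G : Graph) (X B : Subset G) (B∩X=∅ : ∀ v → B v ≡ true → X v ≡ false)
        → Elems G B ⤖ Elems (G ─ X) (λ w → B (proj₁ w))
Elems-─ G X B B∩X=∅ = ↔⇒⤖ (mk↔ₛ′
  (λ { (v , v∈B) → (v , B∩X=∅ v v∈B) , v∈B })
  (λ { ((v , _) , v∈B) → v , v∈B })
  (λ { ((v , v∉X) , v∈B) → cong (λ p → (v , p) , v∈B) (bool-uip _ v∉X) })
  (λ _ → refl))

mainTheorem7 : (r : ℕ) → 1 ≤ r → (G : Graph) (D : V G → V G → Set)
    → IsOrientation G D → RepresentsDistances r G D
    → (P : Problem) → DistanceDetermined r P
    → (X B : Subset G) → (∀ v → B v ≡ true → ¬ Y G D r X v)
    → P G B ⇔ P (G ─ X) (λ w → B (proj₁ w))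
mainTheorem7 r _ G D ori rep P distanceDetermined X B B∩Y=∅ =
  distanceDetermined G (G ─ X) B (λ w → B (proj₁ w))
    (Elems-─ G X B (λ v v∈B → ¬Y⇒∉X r G D X (B∩Y=∅ v v∈B)))
    (λ { (u , u∈B) (v , v∈B) → TruncDist-cong
           (DistLE-─ r G D ori rep X (B∩Y=∅ u u∈B) (B∩Y=∅ v v∈B)) })
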